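{- Let $F$ be a set, $\mathcal D$ a filter on $F$, and $(\langle U_f,\gamma_f\rangle)_{f\in F}$ a collection of evaluated systems of a generalized second-order signature $\Sigma_2^g$ such that each $\langle U_f,\gamma_f\rangle$ is a model of the equality axioms E1–E4 (i.e. each $U_f$ has true generalized equalities and belongings). Then the infra-$\mathcal D$-product $U=\mathrm{Inf}_{\mathcal D}\prod_{f\in F}U_f$ together with the crossing $\gamma=\bowtie_{f\in F}\gamma_f$ is also a model of E1–E4.
   Context: Types: $0$ is the first-order type; for $k\ge0$, $[\tau_0,\ldots,\tau_k]$ with all $\tau_\mu=0$ is a second-order type; for a set $A$, $0(A)=A$, $\check\tau(A)=A^{k+1}$ and $\tau(A)=\mathcal P(A^{k+1})$ for $\tau=[\tau_0,\ldots,\tau_k]$. A generalized second-order signature $\Sigma_2^g$ has a set $\Theta$ of first- and second-order types (containing $0$ and some second-order type), $\Theta_b$ its second-order types, constant symbols $\sigma^\tau_\omega$ ($\omega\in\Omega_\tau$), symbols $\delta_\tau$ ($\tau\in\Theta$) and $\varepsilon_\tau$ ($\tau\in\Theta_b$), and variables of each type. A system $U=\langle A,S\rangle$ consists of a set $A$, constants $s^\tau_\omega\in\tau(A)$, relations $\approx_\tau\subseteq\tau(A)^2$ containing identity, and $\tilde\in_\tau\subseteq\check\tau(A)\times\tau(A)$ containing membership; an evaluation assigns to each variable $x^\tau$ an element of $\tau(A)$. The axioms E1–E4 (for all $\tau\in\Theta$) say: $\forall x^\tau(x\,\delta_\tau x)$; $\forall x^\tau,y^\tau(x\delta_\tau y\Rightarrow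 y\delta_\tau x)$; $\forall x^\tau,y^\tau,z^\tau(x\delta_\tau y\land y\delta_\tau z\Rightarrow x\delta_\tau z)$; and for $\tau=[\tau_0,\ldots,\tau_k]\in\Theta_b$: $\forall x_0,y_0,\ldots,x_k,y_k,u^\tau,v^\tau(x_0\delta_{\tau_0}y_0\land\ldots\land x_k\delta_{\tau_k}y_k\land u\delta_\tau v\Rightarrow((x_0,\ldots,x_k)\varepsilon_\tau u\Leftrightarrow(y_0,\ldots,y_k)\varepsilon_\tau v))$, where $\delta_\tau$ is interpreted by $\approx_\tau$ and $\varepsilon_\tau$ by $\tilde\in_\tau$; i.e. each $\approx_\tau$ is an equivalence relation and $\tilde\in_\tau$ respects $\approx$. Infra-$\mathcal D$-product: given systems $U_f=\langle A_f,S_f\rangle$ (with structures $s^\tau_{\omega f},\approx_{\tau,f},\tilde\in_{\tau,f}$) and $\mathcal D\subseteq\mathcal P(F)$, let $A=\prod_{f\in F}A_f$. For $p\in A^{k+1}$ and $f\in F$ let $p(f)\in A_f^{k+1}$, $p(f)(\mu)=p(\mu)(f)$; for $P\subseteq A^{k+1}$ let $P\langle f\rangle=\{p(f):p\in P\}$. Constants: for $\tau=0$, $s^\tau_\omega(f)=s^\tau_{\omega f}$; for second-order $\tau$, $s^\tau_\omega=\{p\in\check\tau(A):\forall f\ p(f)\in s^\tau_{\omega f}\}$. Equalities: for $p,q\in A$, $p\approx_0 q$ iff $\exists G\in\mathcal D\,\forall g\in G\ p(g)\approx_{0,g}q(g)$; for second-order $\tau$ and $P,Q\in\tau(A)$,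 $P\approx_\tau Q$ iff $\exists G\in\mathcal D\,\forall g\in G\ P\langle g\rangle\approx_{\tau,g}Q\langle g\rangle$. Belongings: $p\mathrel{\tilde\in_\tau}P$ iff $\exists G\in\mathcal D\,\forall g\in G\ p(g)\mathrel{\tilde\in_{\tau,g}}P\langle g\rangle$. Crossing of evaluations $\gamma_f$ on $U_f$: $\gamma(x)(f)=\gamma_f(x)$ for $x$ of type $0$, and $\gamma(x)=\{p\in\check\tau(A):\forall f\ p(f)\in\gamma_f(x)\}$ for $x$ of second-order type $\tau$. A filter on $F$ is a set $\mathcal D\subseteq\mathcal P(F)$ closed under finite intersections and supersets. -}

module Defs where

open import Data.Nat using (ℕ; suc)
open import Data.Fin using (Fin)
open import Data.Vec using (Vec; map; lookup)
open import Data.Product using (Σ; _×_)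
open import Data.Unit using (⊤)
open import Relation.Binary.PropositionalEquality using (_≡_)

-- The first-order type 0 is always in Θ.  A second-order type [0,…,0]
-- with k+1 entries is coded by the natural number k; Θb k says that this
-- type belongs to Θ_b.
record Signature : Set₁ where
  field
    Θb        : ℕ → Set
    hasSecond : Σ ℕ Θb
    Ω₀        : Set
    Ωb        : (k : ℕ) → Θb k → Set
    Var₀      : Set
    Varb      : (k : ℕ) → Θb k → Set

-- ť(A) = A^{k+1} and τ(A) = 𝒫(A^{k+1}) (subsets as predicates)
Tup : Set → ℕ → Set
Tup A k = Vec A (suc k)

Pred : Set → ℕ → Set₁
Pred A k = Tup A k → Set

record RawSystem (S : Signature) : Set₂ where
  open Signature S
  field
    Carrier : Set
    s₀   : Ω₀ → Carrier
    sb   : (k : ℕ) (t : Θb k) → Ωb k t → Pred Carrier k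
    eq₀  : Carrier → Carrier → Set₁
    eqb  : (k : ℕ) (t : Θb k) → Pred Carrier k → Pred Carrier k → Set₁
    memb : (k : ℕ) (t : Θb k) → Tup Carrier k → Pred Carrier k → Set₁

record IsSystem {S : Signature} (U : RawSystem S) : Set₂ where
  open Signature S
  open RawSystem U
  field
    eq₀-id  : ∀ a → eq₀ a a
    eqb-id  : ∀ k (t : Θb k) (P : Pred Carrier k) → eqb k t P P
    memb-in : ∀ k (t : Θb k) (p : Tup Carrier k) (P : Pred Carrier k) → P p → memb k t p P

record Evaluation {S : Signature} (U : RawSystem S) : Set₁ where
  open Signature S
  open RawSystem U
  field
    val₀ : Var₀ → Carrier
    valb : (k : ℕ) (t : Θb k) → Varb k t → Pred Carrier k

-- ⟨U, γ⟩ is a model of the equality axioms E1–E4.  These axioms are closed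
-- sentences, so their truth does not depend on γ; δ_τ is interpreted by ≈_τ
-- and ε_τ by ∈̃_τ.
record ModelE {S : Signature} (U : RawSystem S) (γ : Evaluation U) : Set₂ where
  open Signature S
  open RawSystem U
  field
    E1₀ : ∀ x → eq₀ x x
    E2₀ : ∀ x y → eq₀ x y → eq₀ y x
    E3₀ : ∀ x y z → eq₀ x y → eq₀ y z → eq₀ x z
    E1b : ∀ k (t : Θb k) (x : Pred Carrier k) → eqb k t x x
    E2b : ∀ k (t : Θb k) (x y : Pred Carrier k) → eqb k t x y → eqb k t y x
    E3b : ∀ k (t : Θb k) (x y z : Pred Carrier k) →
          eqb k t x y → eqb k t y z → eqb k t x z
    E4  : ∀ k (t : Θb k) (xs ys : Tup Carrier k) (u v : Pred Carrier k) →
          (∀ (μ : Fin (suc k)) → eq₀ (lookup xs μ) (lookup ys μ)) →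
          eqb k t u v → (memb k t xs u → memb k t ys v)

record IsFilter (F : Set) (D : (F → Set) → Set) : Set₁ where
  field
    top   : D (λ _ → ⊤)
    inter : ∀ {G H} → D G → D H → D (λ f → G f × H f)
    up    : ∀ {G H} → D G → (∀ f → G f → H f) → D H

module _ {S : Signature} {F : Set} (U : F → RawSystem S) where
  open Signature S
  open RawSystem

  ΠA : Set
  ΠA = (f : F) → Carrier (U f)

  at : ∀ {k} → Tup ΠA k → (f : F) → Tup (Carrier (U f)) k
  at p f = map (λ a → a f) p

  proj : ∀ {k} → Pred ΠA k → (f : F) → Pred (Carrier (U f)) k
  proj P f t = Σ (Tup ΠA _) λ p → P p × at p f ≡ t

  InfProd : ((F → Set) → Set) → RawSystem S
  InfProd D = record
    { Carrier = ΠA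
    ; s₀   = λ ω f → s₀ (U f) ω
    ; sb   = λ k t ω p → ∀ f → sb (U f) k t ω (at p f)
    ; eq₀  = λ p q → Σ (F → Set) λ G → D G × (∀ g → G g → eq₀ (U g) (p g) (q g))
    ; eqb  = λ k t P Q → Σ (F → Set) λ G → D G ×
               (∀ g → G g → eqb (U g) k t (proj P g) (proj Q g))
    ; memb = λ k t p P → Σ (F → Set) λ G → D G ×
               (∀ g → G g → memb (U g) k t (at p g) (proj P g))
    }

  Crossing : (D : (F → Set) → Set) → ((f : F) → Evaluation (U f)) → Evaluation (InfProd D)
  Crossing D γ = record
    { val₀ = λ x f → Evaluation.val₀ (γ f) x
    ; valb = λ k t x p → ∀ f → Evaluation.valb (γ f) k t x (at p f)
    }

-- Every equality and belonging of the infra-D-product is defined by the same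
-- pattern: a property Q g of the factors "holds on some G ∈ D".
--
-- Each axiom for the product then follows by applying the corresponding
-- axiom of every factor pointwise: E1 everywhere, E2 along one witness set,
-- E3 on the intersection of two, and E4 on the intersection of the sets for
-- the k+1 coordinate equalities, the equality of the predicates and the
-- belonging.  The only bookkeeping is that the μ-th coordinate of p(g) is the
-- g-component of the μ-th coordinate of p.
module Submission where

open import Defs
open import Level using (Level)
open import Data.Nat using (ℕ; zero; suc)
open import Data.Fin using (Fin; zero; suc)
open import Data.Vec using (lookup)
open import Data.Vec.Properties using (lookup-map)
open import Data.Product using (Σ; _×_; _,_)
open import Data.Unit using (⊤)
open import Relation.Binary.PropositionalEquality using (sym; subst₂)

module AlmostEverywhere {F : Set} {D : (F → Set) → Set} (filter : IsFilter F D) where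
  open IsFilter filter

  private
    variable
      ℓ : Level
      P Q R : F → Set ℓ

  Eventually : (F → Set ℓ) → Set (Level.suc Level.zero Level.⊔ ℓ)
  Eventually Q = Σ (F → Set) λ G → D G × (∀ g → G g → Q g)

  always : (∀ g → Q g) → Eventually Q
  always q = (λ _ → ⊤) , top , λ g _ → q g

  mono : (∀ g → P g → Q g) → Eventually P → Eventually Q
  mono imp (G , G∈D , p) = G , G∈D , λ g g∈G → imp g (p g g∈G)

  zipWith : (∀ g → P g → Q g → R g) → Eventually P → Eventually Q → Eventually R
  zipWith comb (G , G∈D , p) (H , H∈D , q) =
    (λ f → G f × H f) , inter G∈D H∈D ,
    λ { g (g∈G , g∈H) → comb g (p g g∈G) (q g g∈H) }

  allFin : ∀ n (Q : Fin n → F → Set ℓ) →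
           (∀ μ → Eventually (Q μ)) → Eventually (λ g → ∀ μ → Q μ g)
  allFin zero    Q q = always (λ g ())
  allFin (suc n) Q q =
    zipWith (λ { g q₀ qs zero → q₀ ; g q₀ qs (suc μ) → qs μ })
            (q zero) (allFin n (λ μ → Q (suc μ)) (λ μ → q (suc μ)))

lemma2 : (S : Signature) (F : Set) (D : (F → Set) → Set) → IsFilter F D →
         (U : F → RawSystem S) (γ : (f : F) → Evaluation (U f)) →
         ((f : F) → IsSystem (U f)) →
         ((f : F) → ModelE (U f) (γ f)) →
         ModelE (InfProd U D) (Crossing U D γ)
lemma2 S F D filter U γ _ M = record
  { E1₀ = λ x → always λ g → E1₀ (M g) (x g)
  ; E2₀ = λ x y → mono λ g → E2₀ (M g) _ _
  ; E3₀ = λ x y z → zipWith λ g → E3₀ (M g) _ _ _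
  ; E1b = λ k t x → always λ g → E1b (M g) k t _
  ; E2b = λ k t x y → mono λ g → E2b (M g) k t _ _
  ; E3b = λ k t x y z → zipWith λ g → E3b (M g) k t _ _ _
  ; E4  = λ k t xs ys u v xs≈ys u≈v xs∈u →
      zipWith (λ g coords (u≈v-g , xs∈u-g) →
                 E4 (M g) k t (at U xs g) (at U ys g) (proj U u g) (proj U v g)
                    (coordinatesAt g xs ys coords) u≈v-g xs∈u-g)
              (allFin (suc k) _ xs≈ys) (zipWith (λ _ → _,_) u≈v xs∈u)
  }
  where
  open AlmostEverywhere filter
  open ModelE
  open RawSystem

  coordinatesAt : ∀ g {k} (xs ys : Tup (ΠA U) k) →
    (∀ μ → eq₀ (U g) (lookup xs μ g) (lookup ys μ g)) →
    ∀ μ → eq₀ (U g) (lookup (at U xs g) μ) (lookup (at U ys g) μ)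
  coordinatesAt g xs ys eqs μ =
    subst₂ (eq₀ (U g)) (sym (lookup-map μ (λ a → a g) xs))
                       (sym (lookup-map μ (λ a → a g) ys)) (eqs μ)
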